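{- Let $A$ be an $m$-by-$n$ $(0,1,\ast)$-matrix. If $A'$ is obtained by removing some rows of $A$, then $\mathrm{opt}(A')\geq\mathrm{opt}(A)$. If $A=[B,C]$ where $B$ is an $m$-by-$p$ submatrix of $A$ consisting of its first $p$ columns for some $1\leq p\leq n$ and $C$ consists of the remaining columns, then $\mathrm{opt}(B)\cdot\mathrm{opt}(C)\leq\mathrm{opt}(A)\leq\mathrm{opt}(B)\cdot 2^{n-p}$.
   Context: A $(0,1,\ast)$-matrix has entries in $\{0,1,\ast\}$; arithmetic is over $GF_2$. A completion of a $k$-by-$\ell$ matrix $A$ is obtained by replacing each $\ast$ by $0$ or $1$. An operator $G=(g_1,\dots,g_k):\{0,1\}^\ell\to\{0,1\}^k$ is consistent with $A=(a_{ij})$ if each $g_i$ depends only on variables $x_j$ with $a_{ij}=\ast$. A set $L\subseteq\{0,1\}^\ell$ is a solution for $A$ if there exist a completion $M$ and a consistent $G$ with $M\mathbf{x}=G(\mathbf{x})$ for all $\mathbf{x}\in L$; $\mathrm{opt}(A)$ is the maximum size of a solution. -}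

module Defs where

open import Data.Bool using (Bool; true; false; _∧_; _xor_)
open import Data.Nat using (ℕ; _≤_)
open import Data.Fin using (Fin)
open import Data.Vec using (Vec; lookup)
open import Data.List using (List; length; foldr; map; allFin)
open import Data.List.Relation.Unary.Unique.Propositional using (Unique)
open import Data.List.Membership.Propositional using (_∈_)
open import Data.Product using (Σ; ∃; _×_)
open import Relation.Binary.PropositionalEquality using (_≡_)

data Entry : Set where
  e0 e1 ∗ : Entry

Matrix : ℕ → ℕ → Set
Matrix k ℓ = Fin k → Fin ℓ → Entry

BMatrix : ℕ → ℕ → Set
BMatrix k ℓ = Fin k → Fin ℓ → Bool

IsCompletion : ∀ {k ℓ} → Matrix k ℓ → BMatrix k ℓ → Set
IsCompletion {k} {ℓ} A M =
  (i : Fin k) (j : Fin ℓ) → (A i j ≡ e0 → M i j ≡ false) × (A i j ≡ e1 → M i j ≡ true)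

Operator : ℕ → ℕ → Set
Operator k ℓ = Fin k → Vec Bool ℓ → Bool

Consistent : ∀ {k ℓ} → Matrix k ℓ → Operator k ℓ → Set
Consistent {k} {ℓ} A G =
  (i : Fin k) (x y : Vec Bool ℓ) →
  ((j : Fin ℓ) → A i j ≡ ∗ → lookup x j ≡ lookup y j) → G i x ≡ G i y

mulRow : ∀ {k ℓ} → BMatrix k ℓ → Vec Bool ℓ → Fin k → Bool
mulRow {k} {ℓ} M x i = foldr _xor_ false (map (λ j → M i j ∧ lookup x j) (allFin ℓ))

-- L (a duplicate-free list of vectors, i.e. a finite subset of {0,1}^ℓ) is a solution for A.
IsSolution : ∀ {k ℓ} → Matrix k ℓ → List (Vec Bool ℓ) → Set
IsSolution {k} {ℓ} A L =
  Σ (BMatrix k ℓ) λ M → Σ (Operator k ℓ) λ G →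
    IsCompletion A M × Consistent A G ×
    ((x : Vec Bool ℓ) → x ∈ L → (i : Fin k) → mulRow M x i ≡ G i x)

IsOpt : ∀ {k ℓ} → Matrix k ℓ → ℕ → Set
IsOpt {k} {ℓ} A s =
  (Σ (List (Vec Bool ℓ)) λ L → Unique L × IsSolution A L × length L ≡ s) ×
  ((L : List (Vec Bool ℓ)) → Unique L → IsSolution A L → length L ≤ s)

-- Deleting rows deletes equations, so a solution of A remains a solution. For A = [B , C],
-- completions and consistent operators split columnwise, and over GF(2)
-- M (x ++ y) = M_B x + M_C y. Hence solutions L_B of B and L_C of C combine into the solution
-- L_B × L_C of A (take G (x ++ y) = G_B x + G_C y). Conversely, for a solution L of A and a
-- fixed tail y, the slice {x | x ++ y ∈ L} is a solution of B with operator
-- x ↦ G (x ++ y) + M_C y; summing over the 2^q tails bounds |L|.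
module Submission where

open import Defs
open import Data.Nat using (ℕ; _≤_; _<_; _*_; _^_; _+_)
open import Data.Fin using (Fin; _↑ˡ_; _↑ʳ_)
open import Data.Product using (_×_)

open import Algebra.Bundles using (CommutativeRing)
open import Level using (0ℓ)
open import Data.Bool using (Bool; true; false; _∧_; _xor_)
open import Data.Bool.Properties using (xor-∧-commutativeRing; xor-assoc; xor-same; xor-identityʳ)
import Data.Bool.Properties as Bool
open import Data.Fin using (splitAt)
open import Data.Fin.Properties using (splitAt⁻¹-↑ˡ; splitAt⁻¹-↑ʳ)
open import Data.List
  using (List; []; _∷_; length; foldr; map; filter; cartesianProductWith)
import Data.List as List
open import Data.List.Properties using (map-tabulate; map-id-local; map-∘; length-map; length-++)
open import Data.List.Membership.Propositional using (_∈_)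
open import Data.List.Membership.Propositional.Properties
  using (∈-cartesianProductWith⁺; ∈-cartesianProductWith⁻)
open import Data.List.Relation.Unary.All using (All; []; _∷_)
import Data.List.Relation.Unary.All as All
open import Data.List.Relation.Unary.All.Properties using (all-filter)
import Data.List.Relation.Unary.All.Properties as All
open import Data.List.Relation.Unary.Any using (here; there)
import Data.List.Relation.Unary.Any as Any
open import Data.List.Relation.Unary.Unique.Propositional using (Unique)
import Data.List.Relation.Unary.Unique.Propositional.Properties as Unique
open import Data.Nat using (zero; suc; z≤n)
open import Data.Nat.Properties using (+-mono-≤; +-suc; *-suc; module ≤-Reasoning)
open import Data.Product using (_,_; proj₁; proj₂)
open import Data.Sum using (inj₁; inj₂)
open import Data.Vec using (Vec; []; _∷_; lookup; _++_; take; drop)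
open import Data.Vec.Properties using (lookup-++ˡ; lookup-++ʳ; take++drop≡id; ++-injective; ≡-dec)
import Data.Vec.Functional as VF
import Data.Vec.Functional.Properties as VF
open import Relation.Binary using (DecidableEquality)
open import Relation.Binary.PropositionalEquality
open import Relation.Nullary using (yes; no)
open import Relation.Unary using (Pred; Decidable)
open import Relation.Unary.Properties using (∁?)

open CommutativeRing xor-∧-commutativeRing using (+-monoid)
open import Algebra.Properties.Monoid.Sum +-monoid using (sum; sum-cong-≗)

private
  variable
    k m p q ℓ : ℕ
    X Y : Set

↑-elim : ∀ p {q} {P : Fin (p + q) → Set} →
         (∀ j → P (j ↑ˡ q)) → (∀ j → P (p ↑ʳ j)) → ∀ j → P j
↑-elim p {P = P} left right j with splitAt p j in eq
... | inj₁ j′ = subst P (splitAt⁻¹-↑ˡ eq) (left j′)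
... | inj₂ j′ = subst P (splitAt⁻¹-↑ʳ eq) (right j′)

lookup-take : ∀ p {q} (v : Vec X (p + q)) j → lookup (take p v) j ≡ lookup v (j ↑ˡ q)
lookup-take p v j = trans (sym (lookup-++ˡ (take p v) (drop p v) j))
                          (cong (λ w → lookup w (j ↑ˡ _)) (take++drop≡id p v))

lookup-drop : ∀ p {q} (v : Vec X (p + q)) j → lookup (drop p v) j ≡ lookup v (p ↑ʳ j)
lookup-drop p v j = trans (sym (lookup-++ʳ (take p v) (drop p v) j))
                          (cong (λ w → lookup w (p ↑ʳ j)) (take++drop≡id p v))

take-drop-++ : (x : Vec X p) (y : Vec X q) → take p (x ++ y) ≡ x × drop p (x ++ y) ≡ y
take-drop-++ {p = p} x y = ++-injective (take p (x ++ y)) x (take++drop≡id p (x ++ y))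

take++-fibre : ∀ p {q} {v : Vec X (p + q)} {y : Vec X q} → drop p v ≡ y → take p v ++ y ≡ v
take++-fibre p {v = v} refl = take++drop≡id p v

length-filter+filter-∁ : {P : Pred X 0ℓ} (P? : Decidable P) (xs : List X) →
                         length (filter P? xs) + length (filter (∁? P?) xs) ≡ length xs
length-filter+filter-∁ P? []       = refl
length-filter+filter-∁ P? (x ∷ xs) with P? x
... | yes _ = cong suc (length-filter+filter-∁ P? xs)
... | no  _ = trans (+-suc _ _) (cong suc (length-filter+filter-∁ P? xs))

length-cartesianProductWith : {Z : Set} (f : X → Y → Z) (xs : List X) (ys : List Y) →
                              length (cartesianProductWith f xs ys) ≡ length xs * length ys
length-cartesianProductWith f []       ys = refl
length-cartesianProductWith f (x ∷ xs) ys =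
  trans (length-++ (map (f x) ys))
        (cong₂ _+_ (length-map (f x) ys) (length-cartesianProductWith f xs ys))

module _ (f : X → Y) (_≟_ : DecidableEquality Y) (Q : Pred X 0ℓ) (b : ℕ)
         (fibre-bound : ∀ y {K} → Unique K → All Q K → All (λ x → f x ≡ y) K → length K ≤ b)
         where

  length-≤-fibres : (ys : List Y) {L : List X} → Unique L → All Q L → All (λ x → f x ∈ ys) L →
                    length L ≤ b * length ys
  length-≤-fibres []       {[]}    _  _  _        = z≤n
  length-≤-fibres []       {_ ∷ _} _  _  (() ∷ _)
  length-≤-fibres (y ∷ ys) {L}     uL qL f[L]⊆ = begin
    length L                                         ≡⟨ length-filter+filter-∁ P? L ⟨
    length (filter P? L) + length (filter (∁? P?) L) ≤⟨ +-mono-≤ over-y over-ys ⟩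
    b + b * length ys                                ≡⟨ *-suc b (length ys) ⟨
    b * length (y ∷ ys)                              ∎
    where
    open ≤-Reasoning
    P? : Decidable (λ x → f x ≡ y)
    P? x = f x ≟ y

    over-y : length (filter P? L) ≤ b
    over-y = fibre-bound y (Unique.filter⁺ P? uL) (All.filter⁺ P? qL) (all-filter P? L)

    f[rest]⊆ys : All (λ x → f x ∈ ys) (filter (∁? P?) L)
    f[rest]⊆ys = All.zipWith (λ (fx∈ , fx≢y) → Any.tail fx≢y fx∈)
                             (All.filter⁺ (∁? P?) f[L]⊆ , all-filter (∁? P?) L)

    over-ys : length (filter (∁? P?) L) ≤ b * length ys
    over-ys = length-≤-fibres ys (Unique.filter⁺ (∁? P?) uL) (All.filter⁺ (∁? P?) qL) f[rest]⊆ys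

allVecs : ∀ n → List (Vec Bool n)
allVecs zero    = [] ∷ []
allVecs (suc n) = cartesianProductWith _∷_ (true ∷ false ∷ []) (allVecs n)

length-allVecs : ∀ n → length (allVecs n) ≡ 2 ^ n
length-allVecs zero    = refl
length-allVecs (suc n) = trans (length-cartesianProductWith _∷_ (true ∷ false ∷ []) (allVecs n))
                               (cong (2 *_) (length-allVecs n))

∈-allVecs : ∀ {n} (v : Vec Bool n) → v ∈ allVecs n
∈-allVecs []          = here refl
∈-allVecs (true ∷ v)  = ∈-cartesianProductWith⁺ _∷_ {xs = true ∷ false ∷ []} (here refl) (∈-allVecs v)
∈-allVecs (false ∷ v) = ∈-cartesianProductWith⁺ _∷_ {xs = true ∷ false ∷ []} (there (here refl)) (∈-allVecs v)

takeCols : ∀ p {q} → (Fin k → Fin (p + q) → X) → Fin k → Fin p → X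
takeCols p A i = VF.take p (A i)

dropCols : ∀ p {q} → (Fin k → Fin (p + q) → X) → Fin k → Fin q → X
dropCols p A i = VF.drop p (A i)

_++ᶜ_ : (Fin k → Fin p → X) → (Fin k → Fin q → X) → Fin k → Fin (p + q) → X
(B ++ᶜ C) i = B i VF.++ C i

sum-↑ : ∀ p {q} (f : Fin (p + q) → Bool) → sum f ≡ sum (VF.take p f) xor sum (VF.drop p f)
sum-↑ zero    f = refl
sum-↑ (suc p) f = trans (cong (VF.head f xor_) (sum-↑ p (VF.tail f)))
                        (sym (xor-assoc (VF.head f) _ _))

foldr-xor-tabulate : ∀ {n} (f : Fin n → Bool) → foldr _xor_ false (List.tabulate f) ≡ sum f
foldr-xor-tabulate {zero}  f = refl
foldr-xor-tabulate {suc n} f = cong (VF.head f xor_) (foldr-xor-tabulate (VF.tail f))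

mulRow≡sum : (M : BMatrix k ℓ) (x : Vec Bool ℓ) (i : Fin k) →
             mulRow M x i ≡ sum (λ j → M i j ∧ lookup x j)
mulRow≡sum M x i = trans (cong (foldr _xor_ false) (map-tabulate (λ j → j) row))
                         (foldr-xor-tabulate row)
  where
  row = λ j → M i j ∧ lookup x j

mulRow-cong : (M M′ : BMatrix k ℓ) (x : Vec Bool ℓ) (i : Fin k) →
              (∀ j → M i j ≡ M′ i j) → mulRow M x i ≡ mulRow M′ x i
mulRow-cong M M′ x i eq = begin
  mulRow M x i                      ≡⟨ mulRow≡sum M x i ⟩
  sum (λ j → M i j ∧ lookup x j)    ≡⟨ sum-cong-≗ (λ j → cong (_∧ lookup x j) (eq j)) ⟩
  sum (λ j → M′ i j ∧ lookup x j)   ≡⟨ mulRow≡sum M′ x i ⟨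
  mulRow M′ x i                     ∎
  where open ≡-Reasoning

mulRow-++ : ∀ {p q} (M : BMatrix k (p + q)) (x : Vec Bool p) (y : Vec Bool q) (i : Fin k) →
            mulRow M (x ++ y) i ≡ mulRow (takeCols p M) x i xor mulRow (dropCols p M) y i
mulRow-++ {p = p} {q} M x y i = begin
  mulRow M (x ++ y) i
    ≡⟨ mulRow≡sum M (x ++ y) i ⟩
  sum (λ j → M i j ∧ lookup (x ++ y) j)
    ≡⟨ sum-↑ p _ ⟩
  sum (λ j → M i (j ↑ˡ q) ∧ lookup (x ++ y) (j ↑ˡ q))
    xor sum (λ j → M i (p ↑ʳ j) ∧ lookup (x ++ y) (p ↑ʳ j))
    ≡⟨ cong₂ _xor_ (sum-cong-≗ (λ j → cong (M i (j ↑ˡ q) ∧_) (lookup-++ˡ x y j)))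
                   (sum-cong-≗ (λ j → cong (M i (p ↑ʳ j) ∧_) (lookup-++ʳ x y j))) ⟩
  sum (λ j → M i (j ↑ˡ q) ∧ lookup x j) xor sum (λ j → M i (p ↑ʳ j) ∧ lookup y j)
    ≡⟨ cong₂ _xor_ (mulRow≡sum (takeCols p M) x i) (mulRow≡sum (dropCols p M) y i) ⟨
  mulRow (takeCols p M) x i xor mulRow (dropCols p M) y i
    ∎
  where open ≡-Reasoning

mulRow-++ᶜ : (B : BMatrix k p) (C : BMatrix k q) (x : Vec Bool p) (y : Vec Bool q) (i : Fin k) →
             mulRow (B ++ᶜ C) (x ++ y) i ≡ mulRow B x i xor mulRow C y i
mulRow-++ᶜ B C x y i = trans (mulRow-++ (B ++ᶜ C) x y i) (cong₂ _xor_
  (mulRow-cong (takeCols _ (B ++ᶜ C)) B x i (VF.lookup-++ˡ (B i) (C i)))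
  (mulRow-cong (dropCols _ (B ++ᶜ C)) C y i (VF.lookup-++ʳ (B i) (C i))))

Completes : Entry → Bool → Set
Completes a b = (a ≡ e0 → b ≡ false) × (a ≡ e1 → b ≡ true)

AgreeOnStars : (Fin ℓ → Entry) → Vec Bool ℓ → Vec Bool ℓ → Set
AgreeOnStars {ℓ} r x y = (j : Fin ℓ) → r j ≡ ∗ → lookup x j ≡ lookup y j

IsCompletion-++ᶜ : ∀ {p q} (A : Matrix k (p + q)) {B : BMatrix k p} {C : BMatrix k q} →
                   IsCompletion (takeCols p A) B → IsCompletion (dropCols p A) C →
                   IsCompletion A (B ++ᶜ C)
IsCompletion-++ᶜ {p = p} {q} A {B} {C} cB cC i = ↑-elim p
  (λ j → subst (Completes (A i (j ↑ˡ q))) (sym (VF.lookup-++ˡ (B i) (C i) j)) (cB i j))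
  (λ j → subst (Completes (A i (p ↑ʳ j))) (sym (VF.lookup-++ʳ (B i) (C i) j)) (cC i j))

AgreeOnStars-++ : ∀ {p q} (r : Fin (p + q) → Entry) {x x′ : Vec Bool p} {y y′ : Vec Bool q} →
                  AgreeOnStars (VF.take p r) x x′ → AgreeOnStars (VF.drop p r) y y′ →
                  AgreeOnStars r (x ++ y) (x′ ++ y′)
AgreeOnStars-++ {p = p} r {x} {x′} {y} {y′} agreeˡ agreeʳ = ↑-elim p
  (λ j r≡∗ → trans (lookup-++ˡ x y j) (trans (agreeˡ j r≡∗) (sym (lookup-++ˡ x′ y′ j))))
  (λ j r≡∗ → trans (lookup-++ʳ x y j) (trans (agreeʳ j r≡∗) (sym (lookup-++ʳ x′ y′ j))))

AgreeOnStars-take : ∀ p {q} (r : Fin (p + q) → Entry) {v v′ : Vec Bool (p + q)} →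
                    AgreeOnStars r v v′ → AgreeOnStars (VF.take p r) (take p v) (take p v′)
AgreeOnStars-take p r {v} {v′} agree j r≡∗ =
  trans (lookup-take p v j) (trans (agree (j ↑ˡ _) r≡∗) (sym (lookup-take p v′ j)))

AgreeOnStars-drop : ∀ p {q} (r : Fin (p + q) → Entry) {v v′ : Vec Bool (p + q)} →
                    AgreeOnStars r v v′ → AgreeOnStars (VF.drop p r) (drop p v) (drop p v′)
AgreeOnStars-drop p r {v} {v′} agree j r≡∗ =
  trans (lookup-drop p v j) (trans (agree (p ↑ʳ j) r≡∗) (sym (lookup-drop p v′ j)))

IsSolution-rows : (A : Matrix m ℓ) (f : Fin k → Fin m) {L : List (Vec Bool ℓ)} →
                  IsSolution A L → IsSolution (λ i → A (f i)) L
IsSolution-rows A f (M , G , complete , consistent , solves) =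
  (λ i → M (f i)) , (λ i → G (f i)) , (λ i → complete (f i)) , (λ i → consistent (f i)) ,
  (λ x x∈L i → solves x x∈L (f i))

IsSolution-× : ∀ {p q} (A : Matrix k (p + q)) {LB : List (Vec Bool p)} {LC : List (Vec Bool q)} →
               IsSolution (takeCols p A) LB → IsSolution (dropCols p A) LC →
               IsSolution A (cartesianProductWith _++_ LB LC)
IsSolution-× {p = p} A {LB} {LC} (MB , GB , cB , gB , sB) (MC , GC , cC , gC , sC) =
  MB ++ᶜ MC , G , IsCompletion-++ᶜ A cB cC , consistent , solves
  where
  G : Operator _ _
  G i v = GB i (take p v) xor GC i (drop p v)

  consistent : Consistent A G
  consistent i v v′ agree = cong₂ _xor_
    (gB i _ _ (AgreeOnStars-take p (A i) agree)) (gC i _ _ (AgreeOnStars-drop p (A i) agree))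

  solves : ∀ v → v ∈ cartesianProductWith _++_ LB LC → ∀ i → mulRow (MB ++ᶜ MC) v i ≡ G i v
  solves v v∈ i with ∈-cartesianProductWith⁻ _++_ LB LC v∈
  ... | x , y , x∈LB , y∈LC , refl = begin
    mulRow (MB ++ᶜ MC) (x ++ y) i           ≡⟨ mulRow-++ᶜ MB MC x y i ⟩
    mulRow MB x i xor mulRow MC y i         ≡⟨ cong₂ _xor_ (sB x x∈LB i) (sC y y∈LC i) ⟩
    GB i x xor GC i y                       ≡⟨ cong₂ (λ x′ y′ → GB i x′ xor GC i y′)
                                                     (proj₁ (take-drop-++ x y)) (proj₂ (take-drop-++ x y)) ⟨
    G i (x ++ y)                            ∎
    where open ≡-Reasoning

IsSolution-slice : ∀ {p q} (A : Matrix k (p + q)) (y : Vec Bool q)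
                   {L : List (Vec Bool (p + q))} {K : List (Vec Bool p)} →
                   IsSolution A L → All (λ x → x ++ y ∈ L) K → IsSolution (takeCols p A) K
IsSolution-slice {p = p} A y {K = K} (M , G , complete , consistent , solves) K⊆ =
  takeCols p M , GB , (λ i j → complete i (j ↑ˡ _)) , consistentB , solvesB
  where
  GB : Operator _ p
  GB i x = G i (x ++ y) xor mulRow (dropCols p M) y i

  consistentB : Consistent (takeCols p A) GB
  consistentB i x x′ agree =
    cong (_xor mulRow (dropCols p M) y i)
         (consistent i (x ++ y) (x′ ++ y) (AgreeOnStars-++ (A i) {x} {x′} {y} {y} agree (λ _ _ → refl)))

  solvesB : ∀ x → x ∈ K → ∀ i → mulRow (takeCols p M) x i ≡ GB i x
  solvesB x x∈K i = begin
    mulRow (takeCols p M) x i                        ≡⟨ xor-cancelʳ _ c ⟨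
    (mulRow (takeCols p M) x i xor c) xor c          ≡⟨ cong (_xor c) (mulRow-++ M x y i) ⟨
    mulRow M (x ++ y) i xor c                        ≡⟨ cong (_xor c) (solves (x ++ y) (All.lookup K⊆ x∈K) i) ⟩
    G i (x ++ y) xor c                               ∎
    where
    open ≡-Reasoning
    c : Bool
    c = mulRow (dropCols p M) y i
    xor-cancelʳ : ∀ a b → (a xor b) xor b ≡ a
    xor-cancelʳ a b = trans (xor-assoc a b b) (trans (cong (a xor_) (xor-same b)) (xor-identityʳ a))

opt-removeRows : (A : Matrix m ℓ) (f : Fin k → Fin m) {o o′ : ℕ} →
                 IsOpt A o → IsOpt (λ i → A (f i)) o′ → o ≤ o′
opt-removeRows A f ((L , uL , sL , refl) , _) (_ , maximal) = maximal L uL (IsSolution-rows A f sL)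

opt-*-≤ : ∀ {p q} (A : Matrix k (p + q)) {oA oB oC : ℕ} →
          IsOpt A oA → IsOpt (takeCols p A) oB → IsOpt (dropCols p A) oC → oB * oC ≤ oA
opt-*-≤ A (_ , maximal) ((LB , uB , sB , refl) , _) ((LC , uC , sC , refl) , _) = begin
  length LB * length LC                             ≡⟨ length-cartesianProductWith _++_ LB LC ⟨
  length (cartesianProductWith _++_ LB LC)          ≤⟨ maximal _ unique (IsSolution-× A sB sC) ⟩
  _                                                 ∎
  where
  open ≤-Reasoning
  unique : Unique (cartesianProductWith _++_ LB LC)
  unique = Unique.cartesianProductWith⁺ _++_ (λ {w} {x} → ++-injective w x) uB uC

opt-≤-*-2^ : ∀ {p q} (A : Matrix k (p + q)) {oA oB : ℕ} →
             IsOpt A oA → IsOpt (takeCols p A) oB → oA ≤ oB * 2 ^ q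
opt-≤-*-2^ {p = p} {q} A {oB = oB} ((L , uL , sL , refl) , _) (_ , maximalB) = begin
  length L                 ≤⟨ length-≤-fibres (drop p) (≡-dec Bool._≟_) (_∈ L) oB fibre-bound
                                (allVecs q) uL (All.tabulate (λ v∈L → v∈L))
                                (All.tabulate (λ {v} _ → ∈-allVecs (drop p v))) ⟩
  oB * length (allVecs q)  ≡⟨ cong (oB *_) (length-allVecs q) ⟩
  oB * 2 ^ q               ∎
  where
  open ≤-Reasoning
  fibre-bound : ∀ y {K} → Unique K → All (_∈ L) K → All (λ v → drop p v ≡ y) K → length K ≤ oB
  fibre-bound y {K} uK K⊆L drop≡y = begin
    length K                 ≡⟨ length-map (take p) K ⟨
    length (map (take p) K)  ≤⟨ maximalB _ unique (IsSolution-slice A y sL slice⊆L) ⟩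
    oB                       ∎
    where
    K≡ : map (_++ y) (map (take p) K) ≡ K
    K≡ = trans (sym (map-∘ K)) (map-id-local (All.map (take++-fibre p) drop≡y))
    unique : Unique (map (take p) K)
    unique = Unique.map⁻ (subst Unique (sym K≡) uK)
    slice⊆L : All (λ x → x ++ y ∈ L) (map (take p) K)
    slice⊆L = All.map⁺ (All.zipWith (λ (v∈L , e) → subst (_∈ L) (sym (take++-fibre p e)) v∈L)
                                    (K⊆L , drop≡y))

lemma6 : ((m m' n : ℕ) (A : Matrix m n) (f : Fin m' → Fin m) →
    (∀ i j → i Data.Fin.< j → f i Data.Fin.< f j) →
    (o o' : ℕ) → IsOpt A o → IsOpt (λ i j → A (f i) j) o' → o ≤ o')
    ×
    ((m p q : ℕ) → 1 ≤ p → (A : Matrix m (p + q)) →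
    (oA oB oC : ℕ) →
    IsOpt A oA →
    IsOpt (λ i (j : Fin p) → A i (j ↑ˡ q)) oB →
    IsOpt (λ i (j : Fin q) → A i (p ↑ʳ j)) oC →
    (oB * oC ≤ oA) × (oA ≤ oB * 2 ^ q))
lemma6 =
  (λ m m′ n A f _ o o′ → opt-removeRows A f) ,
  (λ m p q _ A oA oB oC optA optB optC → opt-*-≤ A optA optB optC , opt-≤-*-2^ A optA optB)
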